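{- Let $G$ be a finite, simple, connected graph and let $v$ be a cut vertex of $G$. Then every resolving set for $G$ is disjoint from at most one connected component of $G\setminus\{v\}$. Moreover, if $W$ is a resolving set for $G$ that has nonempty intersection with the vertex sets of at least two distinct components of $G\setminus\{v\}$, then $W\setminus\{v\}$ is a resolving set for $G$.
   Context: For vertices $x,y$ of a connected graph $G$, $d(x,y)$ denotes the length of a shortest $x$–$y$ path. A set $W\subseteq V(G)$ is a resolving set for $G$ if for every two distinct vertices $u,v\in V(G)$ there exists $w\in W$ with $d(u,w)\neq d(v,w)$. A vertex $v$ is a cut vertex of $G$ if the induced subgraph $G\setminus\{v\}$ on $V(G)\setminus\{v\}$ has at least two components. -}

module Defs where

open import Data.Nat using (ℕ; zero; suc; _≤_)
open import Data.Fin using (Fin)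
open import Data.Fin.Subset using (Subset; _∈_)
open import Data.Product using (Σ; ∃; _×_; _,_)
open import Data.Sum using (_⊎_)
open import Data.Unit using (⊤)
open import Relation.Nullary using (¬_; Dec)
open import Relation.Binary.PropositionalEquality using (_≡_; _≢_)

record Graph (n : ℕ) : Set₁ where
  field
    Adj      : Fin n → Fin n → Set
    symAdj   : ∀ {x y} → Adj x y → Adj y x
    irrefl   : ∀ {x} → ¬ Adj x x
    decAdj   : ∀ x y → Dec (Adj x y)
open Graph public

-- WalkIn G P x y k : a walk of length k from x to y in G all of whose
-- vertices satisfy P (i.e. a walk in the subgraph induced by P).
data WalkIn {n : ℕ} (G : Graph n) (P : Fin n → Set) : Fin n → Fin n → ℕ → Set where
  here : ∀ {x} → P x → WalkIn G P x x zero
  step : ∀ {x y z k} → P x → Adj G x y → WalkIn G P y z k → WalkIn G P x z (suc k)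

Walk : {n : ℕ} → Graph n → Fin n → Fin n → ℕ → Set
Walk G = WalkIn G (λ _ → ⊤)

Connected : {n : ℕ} → Graph n → Set
Connected G = ∀ x y → ∃ λ k → Walk G x y k

Dist : {n : ℕ} → Graph n → Fin n → Fin n → ℕ → Set
Dist G x y k = Walk G x y k × (∀ m → Walk G x y m → k ≤ m)

-- a and b lie in the same connected component of G \ {v}
-- (both differ from v and are joined by a walk avoiding v).
SameCompMinus : {n : ℕ} → Graph n → Fin n → Fin n → Fin n → Set
SameCompMinus G v a b = ∃ λ k → WalkIn G (λ u → u ≢ v) a b k

CutVertex : {n : ℕ} → Graph n → Fin n → Set
CutVertex G v = ∃ λ a → ∃ λ b → a ≢ v × b ≢ v × ¬ SameCompMinus G v a b

Resolves : {n : ℕ} → Graph n → Fin n → Fin n → Fin n → Set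
Resolves G w u v = ∃ λ k₁ → ∃ λ k₂ → Dist G u w k₁ × Dist G v w k₂ × k₁ ≢ k₂

Resolving : {n : ℕ} → Graph n → Subset n → Set
Resolving G W = ∀ u v → u ≢ v → ∃ λ w → w ∈ W × Resolves G w u v

MeetsComp : {n : ℕ} → Graph n → Fin n → Subset n → Fin n → Set
MeetsComp G v W a = ∃ λ w → w ∈ W × w ≢ v × SameCompMinus G v a w

-- Vertices of G \ {v} in different components can only be joined through v, and a
-- shortest walk from x to t that passes through v has length d(x,v) + d(v,t).  For two
-- neighbours u, u' of v in different components, a landmark outside both of their
-- components therefore sees them at the same distance 1 + d(v,w); so any resolving set
-- meets one of these two components.  If W meets two components at a and b, every
-- vertex x reaches at least one of a, b only through v; a landmark t reached from y
-- through v that does not resolve x, y gives d(y,v) + d(v,t) = d(x,t) ≤ d(x,v) + d(v,t),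
-- i.e. d(y,v) ≤ d(x,v).  If neither a nor b resolves x and y, this applies in both
-- directions, so v does not resolve them either.
module Submission where

open import Defs
open import Data.Nat using (ℕ; zero; suc; _+_; _≤_; _<_; z≤n; s≤s)
open import Data.Nat.Properties
  using ( ≤-antisym; ≮⇒≥; m<1+n⇒m<n∨m≡n; +-identityʳ; +-suc; +-mono-≤; +-cancelʳ-≤
        ; module ≤-Reasoning )
  renaming (_≟_ to _≟ℕ_)
open import Data.Fin using (Fin) renaming (_≟_ to _≟F_)
open import Data.Fin.Properties using (any?)
open import Data.Fin.Subset using (Subset; _∈_; _-_)
open import Data.Fin.Subset.Properties using (x∈p∧x≢y⇒x∈p-y)
open import Data.Product using (Σ; ∃; _×_; _,_; proj₁; proj₂)
open import Data.Sum using (_⊎_; inj₁; inj₂)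
open import Data.Unit using (tt)
open import Relation.Nullary using (¬_; Dec; yes; no; contradiction)
open import Relation.Nullary.Decidable using (map′; _×-dec_)
open import Relation.Unary using (Decidable)
open import Relation.Binary.PropositionalEquality
  using (_≡_; _≢_; refl; sym; trans; subst; cong)

least-witness : ∀ {P : ℕ → Set} → Decidable P → ∀ {k} → P k →
                Σ ℕ λ m → P m × (∀ j → P j → m ≤ j)
least-witness {P} P? {k} p = search 0 k (λ ()) p
  where
  search : ∀ i k → (∀ {j} → j < i → ¬ P j) → P (i + k) → Σ ℕ λ m → P m × (∀ j → P j → m ≤ j)
  search i k below pk with P? i
  ... | yes pi = i , pi , λ j pj → ≮⇒≥ (λ j<i → below j<i pj)
  search i zero    below pk | no ¬pi = contradiction (subst P (+-identityʳ i) pk) ¬pi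
  search i (suc k) below pk | no ¬pi = search (suc i) k below′ (subst P (+-suc i k) pk)
    where
    below′ : ∀ {j} → j < suc i → ¬ P j
    below′ j<1+i with m<1+n⇒m<n∨m≡n j<1+i
    ... | inj₁ j<i  = below j<i
    ... | inj₂ refl = ¬pi

module _ {n : ℕ} (G : Graph n) where

  private variable
    P : Fin n → Set
    x y z v : Fin n
    k l : ℕ

  _++ʷ_ : WalkIn G P x y k → WalkIn G P y z l → WalkIn G P x z (k + l)
  here _     ++ʷ w = w
  step p a r ++ʷ w = step p a (r ++ʷ w)

  walkIn-end : WalkIn G P x y k → P y
  walkIn-end (here p)     = p
  walkIn-end (step _ _ r) = walkIn-end r

  walkIn-snoc : WalkIn G P x y k → Adj G y z → P z → WalkIn G P x z (suc k)
  walkIn-snoc (here p)     a pz = step p a (here pz)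
  walkIn-snoc (step p a r) b pz = step p a (walkIn-snoc r b pz)

  walkIn-reverse : WalkIn G P x y k → WalkIn G P y x k
  walkIn-reverse (here p)     = here p
  walkIn-reverse (step p a r) = walkIn-snoc (walkIn-reverse r) (symAdj G a) p

  walkIn-length0⇒≡ : WalkIn G P x y 0 → x ≡ y
  walkIn-length0⇒≡ (here _) = refl

  sameCompMinus-end : SameCompMinus G v x y → y ≢ v
  sameCompMinus-end (_ , w) = walkIn-end w

  sameCompMinus-sym : SameCompMinus G v x y → SameCompMinus G v y x
  sameCompMinus-sym (_ , w) = _ , walkIn-reverse w

  sameCompMinus-trans : SameCompMinus G v x y → SameCompMinus G v y z → SameCompMinus G v x z
  sameCompMinus-trans (_ , w) (_ , w′) = _ , w ++ʷ w′

  walk-avoids⊎through : ∀ v → Walk G x z k →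
    WalkIn G (_≢ v) x z k ⊎ (∃ λ p → ∃ λ q → p + q ≡ k × Walk G x v p × Walk G v z q)
  walk-avoids⊎through {x} v w with x ≟F v
  ... | yes refl = inj₂ (0 , _ , refl , here tt , w)
  walk-avoids⊎through v (here _)     | no x≢v = inj₁ (here x≢v)
  walk-avoids⊎through v (step _ a r) | no x≢v with walk-avoids⊎through v r
  ... | inj₁ r′                   = inj₁ (step x≢v a r′)
  ... | inj₂ (p , q , e , r₁ , r₂) = inj₂ (suc p , q , cong suc e , step tt a r₁ , r₂)

  neighbour-in-component : x ≢ v → Walk G x v k → ∃ λ u → Adj G u v × SameCompMinus G v x u
  neighbour-in-component x≢v (here _) = contradiction refl x≢v
  neighbour-in-component {v = v} x≢v (step {y = y} _ a r) with y ≟F v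
  ... | yes refl = _ , a , 0 , here x≢v
  ... | no y≢v with neighbour-in-component y≢v r
  ...   | u , u~v , l , w = u , u~v , suc l , step x≢v a w

  walk? : ∀ m x y → Dec (Walk G x y m)
  walk? zero    x y = map′ (λ { refl → here tt }) walkIn-length0⇒≡ (x ≟F y)
  walk? (suc m) x y =
    map′ (λ (_ , a , w) → step tt a w) (λ { (step _ a w) → _ , a , w })
         (any? λ z → decAdj G x z ×-dec walk? m z y)

  Dist-unique : Dist G x y k → Dist G x y l → k ≡ l
  Dist-unique (wk , min-k) (wl , min-l) = ≤-antisym (min-k _ wl) (min-l _ wk)

  Dist-adjacent : Adj G x y → Dist G x y 1
  Dist-adjacent x~y = step tt x~y (here tt) , λ
    { zero w → contradiction (subst (Adj G _) (sym (walkIn-length0⇒≡ w)) x~y) (irrefl G)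
    ; (suc m) _ → s≤s z≤n }

  module Distance (conn : Connected G) where

    d : Fin n → Fin n → ℕ
    d x y = proj₁ (least-witness (λ m → walk? m x y) (proj₂ (conn x y)))

    d-Dist : ∀ x y → Dist G x y (d x y)
    d-Dist x y = proj₂ (least-witness (λ m → walk? m x y) (proj₂ (conn x y)))

    Resolves⇒d≢ : ∀ {w} → Resolves G w x y → d x w ≢ d y w
    Resolves⇒d≢ {x} {y} {w} (_ , _ , Dx , Dy , k≢) e =
      k≢ (trans (Dist-unique Dx (d-Dist x w)) (trans e (Dist-unique (d-Dist y w) Dy)))

    d≢⇒Resolves : ∀ {w} → d x w ≢ d y w → Resolves G w x y
    d≢⇒Resolves {x} {y} {w} ne = _ , _ , d-Dist x w , d-Dist y w , ne

    d-adjacent : Adj G x y → d x y ≡ 1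
    d-adjacent {x} {y} x~y = Dist-unique (d-Dist x y) (Dist-adjacent x~y)

    d-triangle : ∀ x v z → d x z ≤ d x v + d v z
    d-triangle x v z = proj₂ (d-Dist x z) _ (proj₁ (d-Dist x v) ++ʷ proj₁ (d-Dist v z))

    avoids⊎through : ∀ v x z → SameCompMinus G v x z ⊎ d x z ≡ d x v + d v z
    avoids⊎through v x z with walk-avoids⊎through v (proj₁ (d-Dist x z))
    ... | inj₁ w = inj₁ (_ , w)
    ... | inj₂ (p , q , e , wp , wq) = inj₂ (≤-antisym (d-triangle x v z) (begin
      d x v + d v z  ≤⟨ +-mono-≤ (proj₂ (d-Dist x v) p wp) (proj₂ (d-Dist v z) q wq) ⟩
      p + q          ≡⟨ e ⟩
      d x z          ∎))
      where open ≤-Reasoning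

module _ {n : ℕ} (G : Graph n) (conn : Connected G) (v : Fin n) where
  open Distance G conn

  private variable
    a b : Fin n

  d-through-neighbour : ∀ {u} w → Adj G u v → d u w ≡ d u v + d v w → d u w ≡ suc (d v w)
  d-through-neighbour w u~v through = trans through (cong (_+ d v w) (d-adjacent u~v))

  resolving-meets-one-side : (W : Subset n) → Resolving G W →
    ∀ a b → a ≢ v → b ≢ v → ¬ SameCompMinus G v a b →
    MeetsComp G v W a ⊎ MeetsComp G v W b
  resolving-meets-one-side W res a b a≢v b≢v a≁b
    with neighbour-in-component G a≢v (proj₂ (conn a v))
       | neighbour-in-component G b≢v (proj₂ (conn b v))
  ... | u , u~v , a≈u | u′ , u′~v , b≈u′
    with res u u′ (λ { refl → a≁b (sameCompMinus-trans G a≈u (sameCompMinus-sym G b≈u′)) })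
  ... | w , w∈W , w-resolves
    with avoids⊎through v u w | avoids⊎through v u′ w
  ... | inj₁ u≈w | _ =
    inj₁ (w , w∈W , sameCompMinus-end G u≈w , sameCompMinus-trans G a≈u u≈w)
  ... | inj₂ _ | inj₁ u′≈w =
    inj₂ (w , w∈W , sameCompMinus-end G u′≈w , sameCompMinus-trans G b≈u′ u′≈w)
  ... | inj₂ u-through | inj₂ u′-through = contradiction
    (trans (d-through-neighbour w u~v u-through) (sym (d-through-neighbour w u′~v u′-through)))
    (Resolves⇒d≢ w-resolves)

  landmark-through-cut⇒≤ : ∀ x y t → d x t ≡ d y t → d y t ≡ d y v + d v t → d y v ≤ d x v
  landmark-through-cut⇒≤ x y t same through = +-cancelʳ-≤ (d v t) (d y v) (d x v) (begin
    d y v + d v t  ≡⟨ sym through ⟩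
    d y t          ≡⟨ sym same ⟩
    d x t          ≤⟨ d-triangle x v t ⟩
    d x v + d v t  ∎)
    where open ≤-Reasoning

  through-cut-to-one-side : ¬ SameCompMinus G v a b → ∀ x →
    d x a ≡ d x v + d v a ⊎ d x b ≡ d x v + d v b
  through-cut-to-one-side {a} {b} a≁b x with avoids⊎through v x a | avoids⊎through v x b
  ... | inj₂ through | _            = inj₁ through
  ... | inj₁ _       | inj₂ through = inj₂ through
  ... | inj₁ x≈a     | inj₁ x≈b     =
    contradiction (sameCompMinus-trans G (sameCompMinus-sym G x≈a) x≈b) a≁b

  unresolved-across-cut⇒≤ : ¬ SameCompMinus G v a b → ∀ x y →
    d x a ≡ d y a → d x b ≡ d y b → d y v ≤ d x v
  unresolved-across-cut⇒≤ {a} {b} a≁b x y same-a same-b with through-cut-to-one-side a≁b y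
  ... | inj₁ through = landmark-through-cut⇒≤ x y a same-a through
  ... | inj₂ through = landmark-through-cut⇒≤ x y b same-b through

  resolving-minus-cut : (W : Subset n) → Resolving G W →
    (∃ λ a → ∃ λ b → a ∈ W × b ∈ W × a ≢ v × b ≢ v × ¬ SameCompMinus G v a b) →
    Resolving G (W - v)
  resolving-minus-cut W res (a , b , a∈W , b∈W , a≢v , b≢v , a≁b) x y x≢y with res x y x≢y
  ... | w , w∈W , w-resolves with w ≟F v
  ... | no w≢v = w , x∈p∧x≢y⇒x∈p-y w∈W w≢v , w-resolves
  ... | yes refl with d x a ≟ℕ d y a | d x b ≟ℕ d y b
  ... | no ≢a        | _          = a , x∈p∧x≢y⇒x∈p-y a∈W a≢v , d≢⇒Resolves ≢a
  ... | yes _        | no ≢b      = b , x∈p∧x≢y⇒x∈p-y b∈W b≢v , d≢⇒Resolves ≢b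
  ... | yes same-a | yes same-b = contradiction
    (≤-antisym (unresolved-across-cut⇒≤ a≁b y x (sym same-a) (sym same-b))
               (unresolved-across-cut⇒≤ a≁b x y same-a same-b))
    (Resolves⇒d≢ w-resolves)

proposition2p2 : {n : ℕ} (G : Graph n) → Connected G → (v : Fin n) → CutVertex G v →
    ((W : Subset n) → Resolving G W →
      ∀ a b → a ≢ v → b ≢ v → ¬ SameCompMinus G v a b →
      MeetsComp G v W a ⊎ MeetsComp G v W b)
    × ((W : Subset n) → Resolving G W →
      (∃ λ a → ∃ λ b → a ∈ W × b ∈ W × a ≢ v × b ≢ v × ¬ SameCompMinus G v a b) →
      Resolving G (W - v))
proposition2p2 G conn v _ = resolving-meets-one-side G conn v , resolving-minus-cut G conn v
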